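{- Let $r\ge 3$ and let $\mathcal{H}=(\mathcal{V},\mathcal{E})$ be an $r$-uniform bi-hypergraph. If $\mathcal{V}$ has a partition $\mathcal{V}_1,\dots,\mathcal{V}_k$ with $k\le r-1$ such that each $\mathcal{V}_i$ is independent, then $\mathcal{H}$ is colorable.
   Context: A bi-hypergraph is a pair $\mathcal{H}=(\mathcal{V},\mathcal{E})$ with $\mathcal{V}$ a finite set and $\mathcal{E}$ a Sperner family of subsets of $\mathcal{V}$ (edges); it is $r$-uniform if all edges have size $r$. A set $S\subseteq\mathcal{V}$ is independent if no edge is contained in $S$. A proper coloring is a map $f:\mathcal{V}\to\mathbb{N}$ with $1<|\{f(v):v\in e\}|<|e|$ for every edge $e$; $\mathcal{H}$ is colorable if such $f$ exists. -}

module Defs where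

open import Data.Nat using (ℕ; _<_; _≟_)
open import Data.Fin using (Fin)
open import Data.Fin.Subset using (Subset; _⊆_; ∣_∣; _∈_; _∉_)
open import Data.Fin.Subset.Properties using (_∈?_)
open import Data.List using (List; length; map; filter; deduplicate; allFin)
open import Data.List.Membership.Propositional renaming (_∈_ to _∈ˡ_)
open import Data.Product using (_×_; Σ-syntax)
open import Relation.Binary.PropositionalEquality using (_≡_)
open import Relation.Nullary using (¬_)
open import Relation.Nullary.Decidable using (⌊_⌋)
open import Data.Vec using (tabulate)
import Data.Fin

record BiHypergraph (n : ℕ) : Set where
  field
    edges : List (Subset n)
    sperner : ∀ {e e′} → e ∈ˡ edges → e′ ∈ˡ edges → e ⊆ e′ → e ≡ e′

open BiHypergraph public

Uniform : ∀ {n} → ℕ → BiHypergraph n → Set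
Uniform r H = ∀ {e} → e ∈ˡ edges H → ∣ e ∣ ≡ r

Independent : ∀ {n} → BiHypergraph n → Subset n → Set
Independent H S = ∀ {e} → e ∈ˡ edges H → ¬ (e ⊆ S)

elems : ∀ {n} → Subset n → List (Fin n)
elems {n} e = filter (_∈? e) (allFin n)

numColours : ∀ {n} → (Fin n → ℕ) → Subset n → ℕ
numColours f e = length (deduplicate _≟_ (map f (elems e)))

ProperColouring : ∀ {n} → BiHypergraph n → (Fin n → ℕ) → Set
ProperColouring H f = ∀ {e} → e ∈ˡ edges H → (1 < numColours f e) × (numColours f e < ∣ e ∣)

Colourable : ∀ {n} → BiHypergraph n → Set
Colourable H = Σ[ f ∈ (_ → ℕ) ] ProperColouring H f

part : ∀ {n k} → (Fin n → Fin k) → Fin k → Subset n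
part p i = tabulate (λ v → ⌊ p v Data.Fin.≟ i ⌋)

-- Colour every vertex by the index of its part. An edge has at least r ≥ 1 vertices, so if it
-- received a single colour it would lie inside one part, contradicting independence; and it
-- receives at most k ≤ r − 1 < r colours because there are only k parts.
module Submission where

open import Defs
open import Data.Nat using (ℕ; suc; _≤_; _<_; _∸_; z≤n; s≤s; _≟_; _≤?_)
open import Data.Nat.Properties using (≤-trans; ≤-<-trans; ≰⇒>)
open import Data.Fin using (Fin; toℕ; fromℕ<)
open import Data.Fin.Properties using (toℕ<n; toℕ-injective; fromℕ<-injective; injective⇒≤)
import Data.Fin as Fin
open import Data.Fin.Subset using (Subset; _⊆_; ∣_∣; _∈_; Nonempty)
open import Data.Fin.Subset.Properties using (nonempty?; Empty-unique; ∣⊥∣≡0; _∈?_)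
open import Data.Vec.Properties using (lookup∘tabulate; lookup⇒[]=)
open import Data.List using (List; []; _∷_; length; lookup; map; deduplicate)
open import Data.List.Relation.Unary.All as All using (All)
open import Data.List.Relation.Unary.AllPairs using (_∷_)
open import Data.List.Relation.Unary.Any using (here)
open import Data.List.Relation.Unary.Unique.Propositional using (Unique)
open import Data.List.Relation.Unary.Unique.DecPropositional.Properties using (deduplicate-!)
open import Data.List.Membership.Propositional renaming (_∈_ to _∈ˡ_)
open import Data.List.Membership.Propositional.Properties
  using (∈-lookup; ∈-filter⁺; ∈-allFin; ∈-map⁺; ∈-map⁻; ∈-deduplicate⁺; ∈-deduplicate⁻)
open import Data.Product using (_,_)
open import Data.Empty using (⊥-elim)
open import Function using (_∘_)
open import Relation.Binary.PropositionalEquality using (_≡_; refl; sym; trans; cong; subst)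
open import Relation.Nullary using (yes; no; contradiction)
open import Relation.Nullary.Decidable using (isYes≗does; dec-true)

private
  variable
    A : Set
    n k : ℕ

Unique-lookup-injective : ∀ {xs : List A} → Unique xs → ∀ i j → lookup xs i ≡ lookup xs j → i ≡ j
Unique-lookup-injective (_ ∷ _) Fin.zero Fin.zero _ = refl
Unique-lookup-injective (x∉ ∷ _) Fin.zero (Fin.suc j) eq = contradiction eq (All.lookup x∉ (∈-lookup j))
Unique-lookup-injective (x∉ ∷ _) (Fin.suc i) Fin.zero eq = contradiction (sym eq) (All.lookup x∉ (∈-lookup i))
Unique-lookup-injective (_ ∷ u) (Fin.suc i) (Fin.suc j) eq = cong Fin.suc (Unique-lookup-injective u i j eq)

-- Pigeonhole: the entries, read as elements of Fin k, index the list injectively.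
Unique∧All<⇒length≤ : ∀ {xs} → Unique xs → All (_< k) xs → length xs ≤ k
Unique∧All<⇒length≤ {xs = xs} u xs<k = injective⇒≤ {f = index} index-injective
  where
  index : Fin (length xs) → Fin _
  index i = fromℕ< (All.lookup xs<k (∈-lookup i))

  index-injective : ∀ {i j} → index i ≡ index j → i ≡ j
  index-injective {i} {j} eq = Unique-lookup-injective u i j (fromℕ<-injective _ _ _ _ eq)

∈-length≤1⇒≡ : ∀ {xs : List A} {x y} → length xs ≤ 1 → x ∈ˡ xs → y ∈ˡ xs → x ≡ y
∈-length≤1⇒≡ {xs = _ ∷ []} _ (here refl) (here refl) = refl
∈-length≤1⇒≡ {xs = _ ∷ _ ∷ _} (s≤s ())

colours : (Fin n → ℕ) → Subset n → List ℕ
colours f e = deduplicate _≟_ (map f (elems e))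

∈⇒∈-elems : ∀ {e : Subset n} {v} → v ∈ e → v ∈ˡ elems e
∈⇒∈-elems {e = e} v∈e = ∈-filter⁺ (_∈? e) (∈-allFin _) v∈e

∈⇒colour∈ : ∀ (f : Fin n → ℕ) {e v} → v ∈ e → f v ∈ˡ colours f e
∈⇒colour∈ f v∈e = ∈-deduplicate⁺ _≟_ (∈-map⁺ f (∈⇒∈-elems v∈e))

numColours≤1⇒constant : ∀ (f : Fin n → ℕ) {e u v} → numColours f e ≤ 1 → u ∈ e → v ∈ e → f u ≡ f v
numColours≤1⇒constant f ≤1 u∈e v∈e = ∈-length≤1⇒≡ ≤1 (∈⇒colour∈ f u∈e) (∈⇒colour∈ f v∈e)

numColours≤ : ∀ (f : Fin n → ℕ) e → (∀ v → f v < k) → numColours f e ≤ k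
numColours≤ f e f<k = Unique∧All<⇒length≤ (deduplicate-! _≟_ _) (All.tabulate colour<k)
  where
  colour<k : ∀ {c} → c ∈ˡ colours f e → c < _
  colour<k c∈ with ∈-map⁻ f (∈-deduplicate⁻ _≟_ _ c∈)
  ... | v , _ , refl = f<k v

∈-part : ∀ (p : Fin n → Fin k) {i v} → p v ≡ i → v ∈ part p i
∈-part p {i} {v} pv≡i = lookup⇒[]= v (part p i)
  (trans (lookup∘tabulate _ v) (trans (isYes≗does (p v Fin.≟ i)) (dec-true (p v Fin.≟ i) pv≡i)))

0<∣e∣⇒Nonempty : (e : Subset n) → 0 < ∣ e ∣ → Nonempty e
0<∣e∣⇒Nonempty {n} e 0<∣e∣ with nonempty? e
... | yes ne = ne
... | no empty = contradiction (subst (0 <_) ∣e∣≡0 0<∣e∣) λ ()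
  where
  ∣e∣≡0 : ∣ e ∣ ≡ 0
  ∣e∣≡0 = trans (cong ∣_∣ (Empty-unique empty)) (∣⊥∣≡0 n)

partIndex-proper : ∀ {r} (H : BiHypergraph n) (p : Fin n → Fin k) → Uniform r H → k < r →
  (∀ i → Independent H (part p i)) → ProperColouring H (toℕ ∘ p)
partIndex-proper {k = k} H p uniform k<r independent {e} e∈H = more-than-one , fewer-than-size
  where
  k<∣e∣ : k < ∣ e ∣
  k<∣e∣ = subst (k <_) (sym (uniform e∈H)) k<r

  more-than-one : 1 < numColours (toℕ ∘ p) e
  more-than-one with numColours (toℕ ∘ p) e ≤? 1 | 0<∣e∣⇒Nonempty e (≤-trans (s≤s z≤n) k<∣e∣)
  ... | no ≰1 | _ = ≰⇒> ≰1
  ... | yes ≤1 | x , x∈e = ⊥-elim (independent (p x) e∈H e⊆part)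
    where
    e⊆part : e ⊆ part p (p x)
    e⊆part v∈e = ∈-part p (toℕ-injective (numColours≤1⇒constant (toℕ ∘ p) ≤1 v∈e x∈e))

  fewer-than-size : numColours (toℕ ∘ p) e < ∣ e ∣
  fewer-than-size = ≤-<-trans (numColours≤ (toℕ ∘ p) e (toℕ<n ∘ p)) k<∣e∣

corollary2p2 : (r n k : ℕ) → 3 ≤ r → (H : BiHypergraph n) → Uniform r H →
    (p : Fin n → Fin k) → k ≤ r ∸ 1 → (∀ i → Independent H (part p i)) →
    Colourable H
corollary2p2 (suc r) n k _ H uniform p k≤r independent =
  toℕ ∘ p , partIndex-proper H p uniform (s≤s k≤r) independent
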